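{- Let $s_1,t_1,\dots,s_k,t_k$ be positive integers and let $G$ be the threshold graph realized by the code $0^{s_1}1^{t_1}0^{s_2}1^{t_2}\cdots0^{s_k}1^{t_k}$. Then $$\sum_{i=1}^{k}(s_i+t_i-2)\leq \beta(G)\leq \sum_{i=1}^{k}(s_i+t_i-1).$$ If $s_i>1$ and $t_i>1$ for all $1\leq i\leq k$, then the lower bound is attained; and the upper bound is attained if and only if $s_i=1$ (and $t_i\geq 1$) for all $1\leq i\leq k$.
   Context: Threshold graph realized by a binary code $b=b_1b_2\cdots b_n$ (with $b_1=0$): start with a single vertex $v_1$; for $i\geq 2$ add a vertex $v_i$, which is added as an isolated vertex if $b_i=0$ and as a dominating vertex (adjacent to all previously added vertices) if $b_i=1$. Thus for $i<j$, $v_i\sim v_j$ iff $b_j=1$. The notation $0^{s}1^{t}$ means $s$ zeros followed by $t$ ones. For an ordered set $\mathcal{W}=\{w_1,\dots,w_k\}$ of vertices of a connected graph, the representation of a vertex $w$ is $(d(w,w_1),\dots,d(w,w_k))$; $\mathcal{W}$ is a resolving set if all vertices have distinct representations; the metric dimension $\beta(G)$ is the minimum cardinality of a resolving set. -}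

module Defs where

open import Data.Nat using (ℕ; zero; suc; _+_; _∸_; _≤_)
open import Data.Bool using (Bool; true; false)
open import Data.List using (List; []; _∷_; _++_; replicate; concatMap; length; lookup; map)
open import Data.Nat.ListAction using (sum)
open import Data.Fin using (Fin; _<_)
open import Data.Fin.Subset using (Subset; _∈_; ∣_∣)
open import Data.Product using (_×_; _,_; ∃; Σ; uncurry)
open import Data.Sum using (_⊎_)
open import Relation.Binary.PropositionalEquality using (_≡_)

Adj : ℕ → Set₁
Adj n = Fin n → Fin n → Set

data Walk {n : ℕ} (E : Adj n) : Fin n → Fin n → ℕ → Set where
  here : ∀ {u} → Walk E u u 0
  step : ∀ {u w v m} → E u w → Walk E w v m → Walk E u v (suc m)

IsDist : ∀ {n} → Adj n → Fin n → Fin n → ℕ → Set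
IsDist E u v m = Walk E u v m × (∀ m′ → Walk E u v m′ → m ≤ m′)

SameDist : ∀ {n} → Adj n → Fin n → Fin n → Fin n → Set
SameDist E u v w = ∃ λ m → IsDist E u w m × IsDist E v w m

Resolving : ∀ {n} → Adj n → Subset n → Set
Resolving {n} E W = (u v : Fin n) → (∀ w → w ∈ W → SameDist E u v w) → u ≡ v

IsMetricDim : ∀ {n} → Adj n → ℕ → Set
IsMetricDim E β =
  (∃ λ W → Resolving E W × ∣ W ∣ ≡ β) × (∀ W → Resolving E W → β ≤ ∣ W ∣)

-- Threshold graph of a binary code b (b_i = true means 1):
-- for i < j, v_i ~ v_j iff b_j = 1.
ThresholdAdj : (b : List Bool) → Adj (length b)
ThresholdAdj b i j = (i < j × lookup b j ≡ true) ⊎ (j < i × lookup b i ≡ true)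

blockCode : List (ℕ × ℕ) → List Bool
blockCode = concatMap (uncurry λ s t → replicate s false ++ replicate t true)

lowerSum : List (ℕ × ℕ) → ℕ
lowerSum bs = sum (map (uncurry λ s t → s + t ∸ 2) bs)

upperSum : List (ℕ × ℕ) → ℕ
upperSum bs = sum (map (uncurry λ s t → s + t ∸ 1) bs)

-- Every vertex is adjacent to the last one (a 1), so all distances are 0, 1 or 2 and a vertex
-- outside W is seen by W only through its adjacencies. The vertices of one run of the code are
-- twins, so a resolving set misses at most one vertex per run: β ≥ n − 2k = Σ (sᵢ + tᵢ − 2).
-- Conversely, a first 1 of a block is separated from every earlier first 1 by the 0 just before
-- it, so the complement of the k first 1s resolves: β ≤ n − k = Σ (sᵢ + tᵢ − 1); when all runs
-- have length at least two the same argument works for all 2k run starts, so β = n − 2k.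
-- For equality in the upper bound, send a 0 outside W to itself and a 1 outside W to the last 0 of W
-- before it; this is injective, so β ≥ n − Σ sᵢ, which is n − k when every sᵢ = 1. If some
-- sᵢ > 1, a 0 preceded by a 0 can be added to the k first 1s and the complement still resolves.

module Submission where

open import Defs
open import Data.Bool using (Bool; true; false; not; _∧_; _xor_)
open import Data.Bool.Properties using (not-injective; ∧-conicalˡ; ∧-conicalʳ; xor-same)
import Data.Bool as Bool
open import Data.Empty using (⊥; ⊥-elim)
open import Data.Fin using (Fin; zero; suc; toℕ; fromℕ<)
import Data.Fin as Fin
open import Data.Fin.Properties using (toℕ-injective; toℕ<n; toℕ-fromℕ<; injective⇒≤; all?; any?)
import Data.Fin.Properties as Finₚ
open import Data.Fin.Subset using (Subset; inside; outside; _∈_; _∉_; ∣_∣; ∁; ⊤; _∪_; ⁅_⁆)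
open import Data.Fin.Subset.Properties
  using (_∈?_; ∈⊤; anySubset?; x∉p⇒x∈∁p; x∈∁p⇒x∉p; ∣p∣≤n; ∣∁p∣≡n∸∣p∣; p⊂q⇒∣p∣<∣q∣; p⊆q⇒∣p∣≤∣q∣;
         p⊆p∪q; x∈p∪q⁺; x∈p∪q⁻; x∈⁅x⁆; x∈⁅y⁆⇒x≡y)
open import Data.List using (List; []; _∷_; _++_; length; lookup; replicate; map)
open import Data.List.Properties using (++-assoc; ++-identityʳ; length-++; length-replicate)
open import Data.List.Relation.Unary.All using (All; []; _∷_)
import Data.List.Relation.Unary.All as All
open import Data.Nat using (ℕ; zero; suc; _+_; _*_; _∸_; _≤_; _<_; z≤n; s≤s; _≟_; _<?_)
open import Data.Nat.ListAction using (sum)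
open import Data.Nat.Properties
open import Data.Nat.Tactic.RingSolver using (solve-∀)
open import Data.Product using (_×_; _,_; ∃; Σ; proj₁; proj₂; uncurry)
open import Data.Sum using (_⊎_; inj₁; inj₂)
open import Data.Vec using ([]; _∷_; here; there)
open import Data.Vec.Properties using ([]=⇒lookup; lookup⇒[]=)
import Data.Vec as Vec
open import Function using (_∘_; case_of_)
open import Function.Bundles using (_⇔_; mk⇔)
open import Relation.Binary using (tri<; tri≈; tri>)
open import Relation.Binary.PropositionalEquality
open import Relation.Nullary using (¬_; ¬?; Dec; yes; no)
open import Relation.Nullary.Decidable using (_×-dec_; _⊎-dec_; _→-dec_)
open import Relation.Unary using (Decidable)

least-witness : {Q : ℕ → Set} → Decidable Q → ∀ {N} → Q N → ∃ λ k → Q k × (∀ {j} → Q j → k ≤ j)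
least-witness Q? {N} qN with Q? 0
... | yes q0 = 0 , q0 , λ _ → z≤n
least-witness Q? {zero}  qN | no ¬q0 = ⊥-elim (¬q0 qN)
least-witness {Q} Q? {suc N} qN | no ¬q0 with least-witness (λ j → Q? (suc j)) qN
... | k , qk , least = suc k , qk , least′
  where
  least′ : ∀ {j} → Q j → suc k ≤ j
  least′ {zero}  q0 = ⊥-elim (¬q0 q0)
  least′ {suc j} qj = s≤s (least qj)

+≡+⇒≤ : ∀ {a b c d} → a + b ≡ c + d → d ≤ b → a ≤ c
+≡+⇒≤ {a} {b} {c} {d} eq d≤b = +-cancelʳ-≤ d a c (begin
  a + d ≤⟨ +-monoʳ-≤ a d≤b ⟩
  a + b ≡⟨ eq ⟩
  c + d ∎)
  where open ≤-Reasoning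

+≡+⇒< : ∀ {a b c d} → a + b ≡ c + d → d < b → a < c
+≡+⇒< {a} {b} {c} {d} eq d<b = +-cancelʳ-< d a c (begin-strict
  a + d <⟨ +-monoʳ-< a d<b ⟩
  a + b ≡⟨ eq ⟩
  c + d ∎)
  where open ≤-Reasoning

-- Counting subsets of Fin n

enumerate : ∀ {n} (p : Subset n) → Fin ∣ p ∣ → Fin n
enumerate (inside  ∷ p) zero    = zero
enumerate (inside  ∷ p) (suc i) = suc (enumerate p i)
enumerate (outside ∷ p) i       = suc (enumerate p i)

enumerate-∈ : ∀ {n} (p : Subset n) i → enumerate p i ∈ p
enumerate-∈ (inside  ∷ p) zero    = here
enumerate-∈ (inside  ∷ p) (suc i) = there (enumerate-∈ p i)
enumerate-∈ (outside ∷ p) i       = there (enumerate-∈ p i)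

enumerate-injective : ∀ {n} (p : Subset n) {i j} → enumerate p i ≡ enumerate p j → i ≡ j
enumerate-injective (inside  ∷ p) {zero}  {zero}  _  = refl
enumerate-injective (inside  ∷ p) {suc i} {suc j} eq = cong suc (enumerate-injective p (Finₚ.suc-injective eq))
enumerate-injective (outside ∷ p)                 eq = enumerate-injective p (Finₚ.suc-injective eq)

index : ∀ {n} (p : Subset n) {x} → x ∈ p → Fin ∣ p ∣
index (inside  ∷ p) here       = zero
index (inside  ∷ p) (there x∈) = suc (index p x∈)
index (outside ∷ p) (there x∈) = index p x∈

index-injective : ∀ {n} (p : Subset n) {x y} (x∈ : x ∈ p) (y∈ : y ∈ p) → index p x∈ ≡ index p y∈ → x ≡ y
index-injective (inside  ∷ p) here       here       _  = refl
index-injective (inside  ∷ p) (there x∈) (there y∈) eq = cong suc (index-injective p x∈ y∈ (Finₚ.suc-injective eq))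
index-injective (outside ∷ p) (there x∈) (there y∈) eq = cong suc (index-injective p x∈ y∈ eq)

∣p∣≤∣q∣-by-injection : ∀ {m n} (p : Subset m) (q : Subset n) (f : Fin m → Fin n) →
  (∀ {x} → x ∈ p → f x ∈ q) → (∀ {x y} → x ∈ p → y ∈ p → f x ≡ f y → x ≡ y) → ∣ p ∣ ≤ ∣ q ∣
∣p∣≤∣q∣-by-injection p q f f∈ f-inj = injective⇒≤ {f = g} g-inj
  where
  g : Fin ∣ p ∣ → Fin ∣ q ∣
  g i = index q (f∈ (enumerate-∈ p i))
  g-inj : ∀ {i j} → g i ≡ g j → i ≡ j
  g-inj {i} {j} eq = enumerate-injective p
    (f-inj (enumerate-∈ p i) (enumerate-∈ p j) (index-injective q (f∈ (enumerate-∈ p i)) (f∈ (enumerate-∈ p j)) eq))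

∣p∣+∣∁p∣≡n : ∀ {n} (p : Subset n) → ∣ p ∣ + ∣ ∁ p ∣ ≡ n
∣p∣+∣∁p∣≡n p = trans (cong (∣ p ∣ +_) (∣∁p∣≡n∸∣p∣ p)) (m+[n∸m]≡n (∣p∣≤n p))

∣∁p∣+∣p∣≡n : ∀ {n} (p : Subset n) → ∣ ∁ p ∣ + ∣ p ∣ ≡ n
∣∁p∣+∣p∣≡n p = trans (+-comm ∣ ∁ p ∣ ∣ p ∣) (∣p∣+∣∁p∣≡n p)

∣q∣<∣p∣⇒∃∈p∉q : ∀ {n} {p q : Subset n} → ∣ q ∣ < ∣ p ∣ → ∃ λ x → x ∈ p × x ∉ q
∣q∣<∣p∣⇒∃∈p∉q {p = p} {q} ∣q∣<∣p∣ with any? (λ x → (x ∈? p) ×-dec ¬? (x ∈? q))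
... | yes found = found
... | no  none  = ⊥-elim (<⇒≱ ∣q∣<∣p∣ (p⊆q⇒∣p∣≤∣q∣ p⊆q))
  where
  p⊆q : ∀ {x} → x ∈ p → x ∈ q
  p⊆q {x} x∈p with x ∈? q
  ... | yes x∈q = x∈q
  ... | no  x∉q = ⊥-elim (none (x , x∈p , x∉q))

∉∧∈⇒≢ : ∀ {n} {p : Subset n} {x y} → x ∉ p → y ∈ p → x ≢ y
∉∧∈⇒≢ x∉ y∈ refl = x∉ y∈

injectiveOn-by-< : ∀ {n} {A : Set} (p : Subset n) (f : Fin n → A) →
  (∀ {x y} → x ∈ p → y ∈ p → toℕ x < toℕ y → f x ≡ f y → x ≡ y) →
  ∀ {x y} → x ∈ p → y ∈ p → f x ≡ f y → x ≡ y
injectiveOn-by-< p f inj< {x} {y} x∈ y∈ eq with <-cmp (toℕ x) (toℕ y)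
... | tri< x<y _ _ = inj< x∈ y∈ x<y eq
... | tri≈ _ x≡y _ = toℕ-injective x≡y
... | tri> _ _ y<x = sym (inj< y∈ x∈ y<x (sym eq))

memberAt : ∀ {n} → Subset n → ℕ → Bool
memberAt []      _       = false
memberAt (x ∷ p) zero    = x
memberAt (x ∷ p) (suc i) = memberAt p i

memberAt⁺ : ∀ {n} (p : Subset n) {x} → x ∈ p → memberAt p (toℕ x) ≡ true
memberAt⁺ (_ ∷ p) here      = refl
memberAt⁺ (_ ∷ p) (there x∈) = memberAt⁺ p x∈

memberAt⁻ : ∀ {n} (p : Subset n) x → memberAt p (toℕ x) ≡ true → x ∈ p
memberAt⁻ (true ∷ p) zero    _   = here
memberAt⁻ (_    ∷ p) (suc x) mem = there (memberAt⁻ p x mem)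

lastTrue : (ℕ → Bool) → ℕ → ℕ
lastTrue f zero = zero
lastTrue f (suc p) with f (suc p)
... | true  = suc p
... | false = lastTrue f p

lastTrue-≤ : ∀ (f : ℕ → Bool) p → lastTrue f p ≤ p
lastTrue-≤ f zero = z≤n
lastTrue-≤ f (suc p) with f (suc p)
... | true  = ≤-refl
... | false = m≤n⇒m≤1+n (lastTrue-≤ f p)

lastTrue-true : ∀ (f : ℕ → Bool) {p q} → q ≤ p → f q ≡ true → f (lastTrue f p) ≡ true
lastTrue-true f {zero} z≤n fq = fq
lastTrue-true f {suc p} q≤p fq with f (suc p) in eq
... | true = eq
... | false with m≤n⇒m<n∨m≡n q≤p
...   | inj₁ (s≤s q≤p′) = lastTrue-true f q≤p′ fq
...   | inj₂ refl with () ← trans (sym fq) eq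

lastTrue-last : ∀ (f : ℕ → Bool) {p q} → lastTrue f p < q → q ≤ p → f q ≡ false
lastTrue-last f {zero} () z≤n
lastTrue-last f {suc p} last<q q≤p with f (suc p) in eq
... | true = ⊥-elim (<⇒≱ last<q q≤p)
... | false with m≤n⇒m<n∨m≡n q≤p
...   | inj₁ (s≤s q≤p′) = lastTrue-last f last<q q≤p′
...   | inj₂ refl       = eq

-- Distances and resolving sets

module _ {n} {E : Adj n} where

  walk-0 : ∀ {u v} → Walk E u v 0 → u ≡ v
  walk-0 here = refl

  isDist-0 : ∀ u → IsDist E u u 0
  isDist-0 u = here , λ _ _ → z≤n

  isDist-unique : ∀ {u v k l} → IsDist E u v k → IsDist E u v l → k ≡ l
  isDist-unique (w , k-least) (w′ , l-least) = ≤-antisym (k-least _ w′) (l-least _ w)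

  sameDist-swap : ∀ {u v w} → SameDist E u v w → SameDist E v u w
  sameDist-swap (k , d-uw , d-vw) = k , d-vw , d-uw

  sameDist-self : ∀ {u v} → SameDist E u v u → v ≡ u
  sameDist-self {u} (k , d-uu , d-vu) with isDist-unique d-uu (isDist-0 u)
  ... | refl = walk-0 (proj₁ d-vu)

  ⊤-resolving : Resolving E ⊤
  ⊤-resolving u v same = sym (sameDist-self (same u ∈⊤))

  metricDimension : (∀ W → Dec (Resolving E W)) → ∃ (IsMetricDim E)
  metricDimension resolving? =
    let (β , attained , least) = least-witness size? (⊤ , ⊤-resolving , refl)
    in β , attained , λ W res → least (W , res , refl)
    where
    size? : Decidable (λ k → ∃ λ W → Resolving E W × ∣ W ∣ ≡ k)
    size? k = anySubset? (λ W → resolving? W ×-dec (∣ W ∣ ≟ k))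

module DiameterTwo {n} (E : Adj n) (E-sym : ∀ {u v} → E u v → E v u) (E-irrefl : ∀ {u} → ¬ E u u)
                   (E? : ∀ u v → Dec (E u v)) (hub : Fin n) (hub-adj : ∀ {u} → u ≢ hub → E u hub) where

  isDist-1 : ∀ {u v} → E u v → IsDist E u v 1
  isDist-1 {u} {v} e = step e here , least
    where
    least : ∀ k → Walk E u v k → 1 ≤ k
    least zero w with refl ← walk-0 w = ⊥-elim (E-irrefl e)
    least (suc k) w = s≤s z≤n

  isDist-2 : ∀ {u v} → u ≢ v → ¬ E u v → IsDist E u v 2
  isDist-2 {u} {v} u≢v ¬e = via-hub , least
    where
    via-hub : Walk E u v 2
    via-hub with u Fin.≟ hub | v Fin.≟ hub
    ... | yes refl | _        = ⊥-elim (¬e (E-sym (hub-adj (u≢v ∘ sym))))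
    ... | no _     | yes refl = ⊥-elim (¬e (hub-adj u≢v))
    ... | no u≢hub | no v≢hub = step (hub-adj u≢hub) (step (E-sym (hub-adj v≢hub)) here)
    least : ∀ k → Walk E u v k → 2 ≤ k
    least zero w = ⊥-elim (u≢v (walk-0 w))
    least (suc zero) (step e here) = ⊥-elim (¬e e)
    least (suc (suc k)) w = s≤s (s≤s z≤n)

  distance : ∀ u v → ∃ (IsDist E u v)
  distance u v with u Fin.≟ v | E? u v
  ... | yes refl | _     = 0 , isDist-0 u
  ... | no _     | yes e = 1 , isDist-1 e
  ... | no u≢v   | no ¬e = 2 , isDist-2 u≢v ¬e

  sameDist? : ∀ u v w → Dec (SameDist E u v w)
  sameDist? u v w with distance u w | distance v w
  ... | k , d-uw | l , d-vw with k ≟ l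
  ...   | yes refl = yes (k , d-uw , d-vw)
  ...   | no k≢l   = no λ (j , d-uw′ , d-vw′) → k≢l (trans (isDist-unique d-uw d-uw′) (isDist-unique d-vw′ d-vw))

  resolving? : ∀ W → Dec (Resolving E W)
  resolving? W = all? λ u → all? λ v → all? (λ w → (w ∈? W) →-dec sameDist? u v w) →-dec (u Fin.≟ v)

  SameAdj : Fin n → Fin n → Fin n → Set
  SameAdj u v w = (E u w → E v w) × (E v w → E u w)

  Separates : Fin n → Fin n → Fin n → Set
  Separates u v w = (E u w × ¬ E v w) ⊎ (E v w × ¬ E u w)

  separates-sym : ∀ {u v w} → Separates u v w → Separates v u w
  separates-sym (inj₁ sep) = inj₂ sep
  separates-sym (inj₂ sep) = inj₁ sep

  resolving-sameAdj⇒≡ : ∀ {W u v} → Resolving E W → u ∉ W → v ∉ W → (∀ {w} → w ∈ W → SameAdj u v w) → u ≡ v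
  resolving-sameAdj⇒≡ {W} {u} {v} res u∉ v∉ same =
    res u v λ w w∈ → sameDist (same w∈) (∉∧∈⇒≢ u∉ w∈) (∉∧∈⇒≢ v∉ w∈)
    where
    sameDist : ∀ {w} → SameAdj u v w → u ≢ w → v ≢ w → SameDist E u v w
    sameDist {w} (to , from) u≢w v≢w with E? u w
    ... | yes e = 1 , isDist-1 e , isDist-1 (to e)
    ... | no ¬e = 2 , isDist-2 u≢w ¬e , isDist-2 v≢w (¬e ∘ from)

  separates⇒¬sameDist : ∀ {u v w} → Separates u v w → u ≢ w → v ≢ w → ¬ SameDist E u v w
  separates⇒¬sameDist (inj₁ (e , ¬e)) _ v≢w (k , d-uw , d-vw)
    with () ← trans (isDist-unique (isDist-1 e) d-uw) (isDist-unique d-vw (isDist-2 v≢w ¬e))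
  separates⇒¬sameDist (inj₂ (e , ¬e)) u≢w _ (k , d-uw , d-vw)
    with () ← trans (isDist-unique (isDist-1 e) d-vw) (isDist-unique d-uw (isDist-2 u≢w ¬e))

  separated⇒∁-resolving : (U : Subset n) →
    (∀ {u v} → u ∈ U → v ∈ U → toℕ u < toℕ v → ∃ λ w → w ∉ U × Separates u v w) → Resolving E (∁ U)
  separated⇒∁-resolving U separator u v same = resolve (u ∈? U) (v ∈? U)
    where
    unresolved : ∀ {x y} → x ∈ U → y ∈ U → ∃ (λ w → w ∉ U × Separates x y w) →
                 (∀ {w} → w ∉ U → SameDist E x y w) → ⊥
    unresolved x∈ y∈ (w , w∉ , sep) same′ =
      separates⇒¬sameDist sep (∉∧∈⇒≢ w∉ x∈ ∘ sym) (∉∧∈⇒≢ w∉ y∈ ∘ sym) (same′ w∉)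
    resolve : Dec (u ∈ U) → Dec (v ∈ U) → u ≡ v
    resolve (no u∉) _      = sym (sameDist-self (same u (x∉p⇒x∈∁p u∉)))
    resolve (yes _) (no v∉) = sameDist-self (sameDist-swap (same v (x∉p⇒x∈∁p v∉)))
    resolve (yes u∈) (yes v∈) with <-cmp (toℕ u) (toℕ v)
    ... | tri≈ _ eq _  = toℕ-injective eq
    ... | tri< u<v _ _ = ⊥-elim (unresolved u∈ v∈ (separator u∈ v∈ u<v) (same _ ∘ x∉p⇒x∈∁p))
    ... | tri> _ _ v<u = ⊥-elim (unresolved v∈ u∈ (separator v∈ u∈ v<u) (sameDist-swap ∘ same _ ∘ x∉p⇒x∈∁p))

-- Binary codes

-- Past the end of the code every position reads as 1 (a junk value).
bitAt : List Bool → ℕ → Bool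
bitAt []      _       = true
bitAt (x ∷ b) zero    = x
bitAt (x ∷ b) (suc p) = bitAt b p

lookup-bitAt : ∀ b (i : Fin (length b)) → lookup b i ≡ bitAt b (toℕ i)
lookup-bitAt (x ∷ b) zero    = refl
lookup-bitAt (x ∷ b) (suc i) = lookup-bitAt b i

Pattern : Set
Pattern = Bool → Bool → Bool

-- f sees the bits at p − 1 and p; at p = 0 it sees pr as the previous bit.
occursIn : Pattern → Bool → List Bool → ℕ → Bool
occursIn f pr b p = f (bitAt (pr ∷ b) p) (bitAt b p)

marks : Pattern → Bool → (b : List Bool) → Subset (length b)
marks f pr []      = []
marks f pr (x ∷ b) = f pr x ∷ marks f x b

lookup-marks : ∀ f pr b (i : Fin (length b)) → Vec.lookup (marks f pr b) i ≡ occursIn f pr b (toℕ i)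
lookup-marks f pr (x ∷ b) zero    = refl
lookup-marks f pr (x ∷ b) (suc i) = lookup-marks f x b i

isZero isRunStart isRise isFall : Pattern
isZero     _  x = not x
isRunStart pr x = pr xor x
isRise     pr x = not pr ∧ x
isFall     pr x = pr ∧ not x

xor≡false⇒≡ : ∀ x y → x xor y ≡ false → x ≡ y
xor≡false⇒≡ false false _ = refl
xor≡false⇒≡ true  true  _ = refl

xor≡true⇒≡not : ∀ x y → x xor y ≡ true → x ≡ not y
xor≡true⇒≡not false true  _ = refl
xor≡true⇒≡not true  false _ = refl

rise⇒bits : ∀ x y → isRise x y ≡ true → x ≡ false × y ≡ true
rise⇒bits false true _ = refl , refl

RunStartsIsolated : Bool → List Bool → Set
RunStartsIsolated pr b = ∀ q → occursIn isRunStart pr b (suc q) ≡ true → occursIn isRunStart pr b q ≡ false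

-- Threshold graphs

module Threshold (b : List Bool) (m : ℕ) (length≡ : length b ≡ suc m)
                 (first-0 : bitAt b 0 ≡ false) (last-1 : bitAt b m ≡ true) where

  V : Set
  V = Fin (length b)

  E : Adj (length b)
  E = ThresholdAdj b

  bit : V → Bool
  bit u = bitAt b (toℕ u)

  E⁺ : ∀ {u w} → toℕ u < toℕ w → bit w ≡ true → E u w
  E⁺ {w = w} u<w w-1 = inj₁ (u<w , trans (lookup-bitAt b w) w-1)

  E-sym : ∀ {u w} → E u w → E w u
  E-sym (inj₁ e) = inj₂ e
  E-sym (inj₂ e) = inj₁ e

  E⁻ : ∀ {u w} → E u w → (toℕ u < toℕ w × bit w ≡ true) ⊎ (toℕ w < toℕ u × bit u ≡ true)
  E⁻ {u} {w} (inj₁ (u<w , w-1)) = inj₁ (u<w , trans (sym (lookup-bitAt b w)) w-1)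
  E⁻ {u} {w} (inj₂ (w<u , u-1)) = inj₂ (w<u , trans (sym (lookup-bitAt b u)) u-1)

  ¬E : ∀ {u w} → (toℕ u < toℕ w → bit w ≡ false) → (toℕ w < toℕ u → bit u ≡ false) → ¬ E u w
  ¬E w-0 u-0 e with E⁻ e
  ... | inj₁ (u<w , w-1) with () ← trans (sym w-1) (w-0 u<w)
  ... | inj₂ (w<u , u-1) with () ← trans (sym u-1) (u-0 w<u)

  E-irrefl : ∀ {u} → ¬ E u u
  E-irrefl e with E⁻ e
  ... | inj₁ (u<u , _) = <-irrefl refl u<u
  ... | inj₂ (u<u , _) = <-irrefl refl u<u

  E? : ∀ u w → Dec (E u w)
  E? u w = ((toℕ u <? toℕ w) ×-dec (lookup b w Bool.≟ true)) ⊎-dec ((toℕ w <? toℕ u) ×-dec (lookup b u Bool.≟ true))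

  vertexAt : ∀ {p} (v : V) → p ≤ toℕ v → Σ V λ w → toℕ w ≡ p
  vertexAt v p≤v = fromℕ< (≤-<-trans p≤v (toℕ<n v)) , toℕ-fromℕ< _

  hub : V
  hub = fromℕ< (subst (m <_) (sym length≡) ≤-refl)

  hub-adj : ∀ {u} → u ≢ hub → E u hub
  hub-adj {u} u≢hub = E⁺ u<hub (trans (cong (bitAt b) toℕ-hub) last-1)
    where
    toℕ-hub : toℕ hub ≡ m
    toℕ-hub = toℕ-fromℕ< _
    u<hub : toℕ u < toℕ hub
    u<hub = subst (toℕ u <_) (sym toℕ-hub) (≤∧≢⇒< (m<1+n⇒m≤n (subst (toℕ u <_) length≡ (toℕ<n u)))
                                                  (λ eq → u≢hub (toℕ-injective (trans eq (sym toℕ-hub)))))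

  open DiameterTwo E E-sym E-irrefl E? hub hub-adj public

  positions-≢ : ∀ {p q} → bitAt b p ≡ true → bitAt b q ≡ false → p ≢ q
  positions-≢ p-1 q-0 refl = case trans (sym p-1) q-0 of λ ()

  sameAdj-equalBits : ∀ {u v w} → toℕ u < toℕ v → bit u ≡ bit v → u ≢ w → v ≢ w →
                      (toℕ u < toℕ w → toℕ w < toℕ v → bit w ≡ bit u) → SameAdj u v w
  sameAdj-equalBits {u} {v} {w} u<v u≡v u≢w v≢w between = to , from
    where
    to : E u w → E v w
    to e with E⁻ e
    ... | inj₂ (w<u , u-1) = E-sym (E⁺ (<-trans w<u u<v) (trans (sym u≡v) u-1))
    ... | inj₁ (u<w , w-1) with <-cmp (toℕ w) (toℕ v)
    ...   | tri< w<v _ _ = E-sym (E⁺ w<v (trans (sym u≡v) (trans (sym (between u<w w<v)) w-1)))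
    ...   | tri≈ _ w≡v _ = ⊥-elim (v≢w (toℕ-injective (sym w≡v)))
    ...   | tri> _ _ v<w = E⁺ v<w w-1
    from : E v w → E u w
    from e with E⁻ e
    ... | inj₁ (v<w , w-1) = E⁺ (<-trans u<v v<w) w-1
    ... | inj₂ (w<v , v-1) with <-cmp (toℕ w) (toℕ u)
    ...   | tri< w<u _ _ = E-sym (E⁺ w<u (trans u≡v v-1))
    ...   | tri≈ _ w≡u _ = ⊥-elim (u≢w (toℕ-injective (sym w≡u)))
    ...   | tri> _ _ u<w = E⁺ u<w (trans (between u<w w<v) (trans u≡v v-1))

  sameAdj-rise : ∀ {u v w} → toℕ u < toℕ v → bit u ≡ false → bit v ≡ true → u ≢ w → v ≢ w →
                 toℕ u ≤ toℕ w → (toℕ u < toℕ w → toℕ w < toℕ v → bit w ≡ true) → SameAdj u v w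
  sameAdj-rise {u} {v} {w} u<v u-0 v-1 u≢w v≢w u≤w between = to , from
    where
    to : E u w → E v w
    to e with E⁻ e
    ... | inj₂ (_ , u-1) with () ← trans (sym u-0) u-1
    ... | inj₁ (u<w , w-1) with <-cmp (toℕ w) (toℕ v)
    ...   | tri< w<v _ _ = E-sym (E⁺ w<v v-1)
    ...   | tri≈ _ w≡v _ = ⊥-elim (v≢w (toℕ-injective (sym w≡v)))
    ...   | tri> _ _ v<w = E⁺ v<w w-1
    from : E v w → E u w
    from e with E⁻ e
    ... | inj₁ (v<w , w-1) = E⁺ (<-trans u<v v<w) w-1
    ... | inj₂ (w<v , _) with m≤n⇒m<n∨m≡n u≤w
    ...   | inj₁ u<w  = E⁺ u<w (between u<w w<v)
    ...   | inj₂ u≡w = ⊥-elim (u≢w (toℕ-injective u≡w))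

  zero-separates : ∀ {u v w} → bit v ≡ true → bit w ≡ false → toℕ w < toℕ v → toℕ u < toℕ w ⊎ bit u ≡ false →
                   Separates u v w
  zero-separates v-1 w-0 w<v (inj₁ u<w) = inj₂ (E-sym (E⁺ w<v v-1) , ¬E (λ _ → w-0) (⊥-elim ∘ <-asym u<w))
  zero-separates v-1 w-0 w<v (inj₂ u-0) = inj₂ (E-sym (E⁺ w<v v-1) , ¬E (λ _ → w-0) (λ _ → u-0))

  one-separates : ∀ {u v w} → bit v ≡ false → bit w ≡ true → toℕ u < toℕ w → toℕ w < toℕ v → Separates u v w
  one-separates v-0 w-1 u<w w<v = inj₁ (E⁺ u<w w-1 , ¬E (λ v<w → ⊥-elim (<-asym v<w w<v)) (λ _ → v-0))

  occurs : Pattern → ℕ → Bool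
  occurs f = occursIn f true b

  marked : Pattern → Subset (length b)
  marked f = marks f true b

  zeros runStarts rises falls : Subset (length b)
  zeros     = marked isZero
  runStarts = marked isRunStart
  rises     = marked isRise
  falls     = marked isFall

  ∈-marked⁺ : ∀ f {x} → occurs f (toℕ x) ≡ true → x ∈ marked f
  ∈-marked⁺ f {x} occ = lookup⇒[]= x (marked f) (trans (lookup-marks f true b x) occ)

  ∈-marked⁻ : ∀ f {x} → x ∈ marked f → occurs f (toℕ x) ≡ true
  ∈-marked⁻ f {x} x∈ = trans (sym (lookup-marks f true b x)) ([]=⇒lookup x∈)

  marked-predecessor : ∀ f {x} → x ∈ marked f →
    (toℕ x ≡ 0 × f true (bit x) ≡ true) ⊎ Σ V (λ w → suc (toℕ w) ≡ toℕ x × f (bit w) (bit x) ≡ true)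
  marked-predecessor f {x} x∈ with toℕ x in eq | ∈-marked⁻ f x∈
  ... | zero  | occ = inj₁ (refl , occ)
  ... | suc q | occ with vertexAt x (subst (q ≤_) (sym eq) (n≤1+n q))
  ...   | w , refl = inj₂ (w , refl , occ)

  runStartOf : V → V
  runStartOf u = proj₁ (vertexAt u (lastTrue-≤ (occurs isRunStart) (toℕ u)))

  toℕ-runStartOf : ∀ u → toℕ (runStartOf u) ≡ lastTrue (occurs isRunStart) (toℕ u)
  toℕ-runStartOf u = proj₂ (vertexAt u (lastTrue-≤ (occurs isRunStart) (toℕ u)))

  runStartOf-∈ : ∀ u → runStartOf u ∈ runStarts
  runStartOf-∈ u = ∈-marked⁺ isRunStart (subst (λ p → occurs isRunStart p ≡ true) (sym (toℕ-runStartOf u))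
    (lastTrue-true (occurs isRunStart) {toℕ u} z≤n (cong not first-0)))

  bits-constant : ∀ {r p} → (∀ {q} → r < q → q ≤ p → occurs isRunStart q ≡ false) →
                  ∀ {q} → r ≤ q → q ≤ p → bitAt b q ≡ bitAt b r
  bits-constant no-start {zero} z≤n _ = refl
  bits-constant no-start {suc q} r≤q q≤p with m≤n⇒m<n∨m≡n r≤q
  ... | inj₂ refl = refl
  ... | inj₁ r<q  = trans (sym (xor≡false⇒≡ _ _ (no-start r<q q≤p)))
                          (bits-constant no-start (m<1+n⇒m≤n r<q) (≤-trans (n≤1+n q) q≤p))

  sameRunStart⇒≡ : ∀ {W u v} → Resolving E W → u ∉ W → v ∉ W → toℕ u < toℕ v →
                   runStartOf u ≡ runStartOf v → u ≡ v
  sameRunStart⇒≡ {W} {u} {v} res u∉ v∉ u<v same = resolving-sameAdj⇒≡ res u∉ v∉ λ w∈ →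
    sameAdj-equalBits u<v (trans u≡r (sym (constant r≤v ≤-refl))) (∉∧∈⇒≢ u∉ w∈) (∉∧∈⇒≢ v∉ w∈)
      λ u<w w<v → trans (constant (≤-trans r≤u (<⇒≤ u<w)) (<⇒≤ w<v)) (sym u≡r)
    where
    r = lastTrue (occurs isRunStart) (toℕ v)
    r≤v : r ≤ toℕ v
    r≤v = lastTrue-≤ _ _
    r≤u : r ≤ toℕ u
    r≤u = subst (_≤ toℕ u) (trans (sym (toℕ-runStartOf u)) (trans (cong toℕ same) (toℕ-runStartOf v))) (lastTrue-≤ _ _)
    constant : ∀ {q} → r ≤ q → q ≤ toℕ v → bitAt b q ≡ bitAt b r
    constant = bits-constant (lastTrue-last (occurs isRunStart))
    u≡r : bit u ≡ bitAt b r
    u≡r = constant r≤u (<⇒≤ u<v)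

  ∣∁W∣≤∣runStarts∣ : ∀ {W} → Resolving E W → ∣ ∁ W ∣ ≤ ∣ runStarts ∣
  ∣∁W∣≤∣runStarts∣ {W} res = ∣p∣≤∣q∣-by-injection (∁ W) runStarts runStartOf (λ {u} _ → runStartOf-∈ u)
    (injectiveOn-by-< (∁ W) runStartOf λ u∈ v∈ → sameRunStart⇒≡ res (x∈∁p⇒x∉p u∈) (x∈∁p⇒x∉p v∈))

  zeroIn : Subset (length b) → ℕ → Bool
  zeroIn W p = memberAt W p ∧ not (bitAt b p)

  zeroIn-∈ : ∀ {W w} → w ∈ W → zeroIn W (toℕ w) ≡ not (bit w)
  zeroIn-∈ {W} {w} w∈ = cong (_∧ not (bit w)) (memberAt⁺ W w∈)

  lastZeroIn : Subset (length b) → V → V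
  lastZeroIn W u = proj₁ (vertexAt u (lastTrue-≤ (zeroIn W) (toℕ u)))

  toℕ-lastZeroIn : ∀ W u → toℕ (lastZeroIn W u) ≡ lastTrue (zeroIn W) (toℕ u)
  toℕ-lastZeroIn W u = proj₂ (vertexAt u (lastTrue-≤ (zeroIn W) (toℕ u)))

  -- Otherwise the first vertex, a 0, would have the same neighbours in W as u.
  lastZeroIn-found : ∀ {W u} → Resolving E W → u ∉ W → bit u ≡ true → zeroIn W (toℕ (lastZeroIn W u)) ≡ true
  lastZeroIn-found {W} {u} res u∉ u-1 rewrite toℕ-lastZeroIn W u with zeroIn W (lastTrue (zeroIn W) (toℕ u)) in found
  ... | true  = refl
  ... | false = case trans (sym u-1) (trans (cong bit (sym first≡u)) first-bit) of λ ()
    where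
    none : ∀ {q} → q ≤ toℕ u → zeroIn W q ≡ false
    none {q} q≤u with zeroIn W q in zero-q
    ... | true  = trans (sym (lastTrue-true (zeroIn W) q≤u zero-q)) found
    ... | false = refl
    first : V
    first = proj₁ (vertexAt u z≤n)
    toℕ-first : toℕ first ≡ 0
    toℕ-first = proj₂ (vertexAt u z≤n)
    first-bit : bit first ≡ false
    first-bit = trans (cong (bitAt b) toℕ-first) first-0
    first≤ : ∀ w → toℕ first ≤ toℕ w
    first≤ w = subst (_≤ toℕ w) (sym toℕ-first) z≤n
    first∉ : first ∉ W
    first∉ first∈ with () ← trans (sym (trans (zeroIn-∈ first∈) (cong not first-bit))) (none (first≤ u))
    first<u : toℕ first < toℕ u
    first<u = subst (_< toℕ u) (sym toℕ-first) (n≢0⇒n>0 (positions-≢ u-1 first-0))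
    first≡u : first ≡ u
    first≡u = resolving-sameAdj⇒≡ res first∉ u∉ λ {w} w∈ →
      sameAdj-rise first<u first-bit u-1 (∉∧∈⇒≢ first∉ w∈) (∉∧∈⇒≢ u∉ w∈) (first≤ w)
        λ _ w<u → not-injective (trans (sym (zeroIn-∈ w∈)) (none (<⇒≤ w<u)))

  lastZeroIn-∈ : ∀ {W u} → Resolving E W → u ∉ W → bit u ≡ true → lastZeroIn W u ∈ W
  lastZeroIn-∈ {W} res u∉ u-1 = memberAt⁻ W _ (∧-conicalˡ _ _ (lastZeroIn-found res u∉ u-1))

  -- Two 1s outside W with the same image have only 1s of W between them, hence are twins for W.
  toZero : Subset (length b) → V → V
  toZero W u with bit u
  ... | true  = lastZeroIn W u
  ... | false = u

  toZero-∈ : ∀ {W u} → Resolving E W → u ∉ W → toZero W u ∈ zeros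
  toZero-∈ {W} {u} res u∉ with bit u in u-bit
  ... | true  = ∈-marked⁺ isZero (∧-conicalʳ _ _ (lastZeroIn-found res u∉ u-bit))
  ... | false = ∈-marked⁺ isZero (cong not u-bit)

  toZero-injective : ∀ {W u v} → Resolving E W → u ∉ W → v ∉ W → toℕ u < toℕ v → toZero W u ≡ toZero W v → u ≡ v
  toZero-injective {W} {u} {v} res u∉ v∉ u<v same with bit u in u-bit | bit v in v-bit
  ... | false | false = same
  ... | false | true  = ⊥-elim (u∉ (subst (_∈ W) (sym same) (lastZeroIn-∈ res v∉ v-bit)))
  ... | true  | false = ⊥-elim (v∉ (subst (_∈ W) same (lastZeroIn-∈ res u∉ u-bit)))
  ... | true  | true  = resolving-sameAdj⇒≡ res u∉ v∉ λ {w} w∈ →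
    sameAdj-equalBits u<v (trans u-bit (sym v-bit)) (∉∧∈⇒≢ u∉ w∈) (∉∧∈⇒≢ v∉ w∈) λ u<w w<v →
      trans (not-injective (trans (sym (zeroIn-∈ w∈)) (lastTrue-last (zeroIn W) (last<w u<w) (<⇒≤ w<v)))) (sym u-bit)
    where
    last<w : ∀ {w} → toℕ u < toℕ w → lastTrue (zeroIn W) (toℕ v) < toℕ w
    last<w u<w = subst (_< _) (trans (sym (toℕ-lastZeroIn W u)) (trans (cong toℕ same) (toℕ-lastZeroIn W v)))
                   (≤-<-trans (lastTrue-≤ (zeroIn W) (toℕ u)) u<w)

  ∣∁W∣≤∣zeros∣ : ∀ {W} → Resolving E W → ∣ ∁ W ∣ ≤ ∣ zeros ∣
  ∣∁W∣≤∣zeros∣ {W} res = ∣p∣≤∣q∣-by-injection (∁ W) zeros (toZero W) (toZero-∈ res ∘ x∈∁p⇒x∉p)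
    (injectiveOn-by-< (∁ W) (toZero W) λ u∈ v∈ → toZero-injective res (x∈∁p⇒x∉p u∈) (x∈∁p⇒x∉p v∈))

  zero⇒bit : ∀ {x} → x ∈ zeros → bit x ≡ false
  zero⇒bit x∈ = not-injective (∈-marked⁻ isZero x∈)

  rise⇒ : ∀ {v} → v ∈ rises → bit v ≡ true × Σ V (λ w → suc (toℕ w) ≡ toℕ v × bit w ≡ false)
  rise⇒ v∈ with marked-predecessor isRise v∈
  ... | inj₁ (_ , ())
  ... | inj₂ (w , w+1≡v , occ) = proj₂ (rise⇒bits _ _ occ) , w , w+1≡v , proj₁ (rise⇒bits _ _ occ)

  zero∉rises : ∀ {w} → bit w ≡ false → w ∉ rises
  zero∉rises w-0 w∈ with () ← trans (sym w-0) (proj₁ (rise⇒ w∈))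

  one<zero : ∀ {u w} → bit u ≡ true → bit w ≡ false → toℕ u < suc (toℕ w) → toℕ u < toℕ w
  one<zero u-1 w-0 u≤w = ≤∧≢⇒< (m<1+n⇒m≤n u≤w) (positions-≢ u-1 w-0)

  rise-separator : ∀ {u v} → u ∈ rises → v ∈ rises → toℕ u < toℕ v →
                   Σ V λ w → suc (toℕ w) ≡ toℕ v × bit w ≡ false × Separates u v w
  rise-separator {u} {v} u∈ v∈ u<v with rise⇒ u∈ | rise⇒ v∈
  ... | u-1 , _ | v-1 , w , w+1≡v , w-0 =
    w , w+1≡v , w-0 , zero-separates v-1 w-0 (subst (toℕ w <_) w+1≡v ≤-refl)
                        (inj₁ (one<zero u-1 w-0 (subst (toℕ u <_) (sym w+1≡v) u<v)))

  ∁rises-resolving : Resolving E (∁ rises)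
  ∁rises-resolving = separated⇒∁-resolving rises λ u∈ v∈ u<v →
    let (w , _ , w-0 , sep) = rise-separator u∈ v∈ u<v in w , zero∉rises w-0 , sep

  ∁runStarts-resolving : RunStartsIsolated true b → Resolving E (∁ runStarts)
  ∁runStarts-resolving isolated = separated⇒∁-resolving runStarts separator
    where
    separator : ∀ {u v} → u ∈ runStarts → v ∈ runStarts → toℕ u < toℕ v →
                ∃ λ w → w ∉ runStarts × Separates u v w
    separator {u} {v} u∈ v∈ u<v with marked-predecessor isRunStart v∈
    ... | inj₁ (v≡0 , _) = ⊥-elim (n≮0 (subst (toℕ u <_) v≡0 u<v))
    ... | inj₂ (w , w+1≡v , occ) = w , w∉ , separates (bit v) refl (xor≡true⇒≡not _ _ occ)
      where
      w∉ : w ∉ runStarts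
      w∉ w∈ = case trans (sym (∈-marked⁻ isRunStart w∈)) (isolated (toℕ w) v-start) of λ ()
        where
        v-start : occurs isRunStart (suc (toℕ w)) ≡ true
        v-start = subst (λ p → occurs isRunStart p ≡ true) (sym w+1≡v) (∈-marked⁻ isRunStart v∈)
      w<v : toℕ w < toℕ v
      w<v = subst (toℕ w <_) w+1≡v ≤-refl
      u<w : toℕ u < toℕ w
      u<w = ≤∧≢⇒< (m<1+n⇒m≤n (subst (toℕ u <_) (sym w+1≡v) u<v))
                  (λ u≡w → w∉ (subst (_∈ _) (toℕ-injective u≡w) u∈))
      separates : ∀ x → bit v ≡ x → bit w ≡ not x → Separates u v w
      separates true  v-1 w-0 = zero-separates v-1 w-0 w<v (inj₁ u<w)
      separates false v-0 w-1 = one-separates v-0 w-1 u<w w<v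

  zero-after-zero : ∀ {x} → x ∈ zeros → x ∉ falls → Σ V λ w → suc (toℕ w) ≡ toℕ x × bit w ≡ false
  zero-after-zero {x} x∈ x∉ with marked-predecessor isZero x∈
  ... | inj₁ (x≡0 , _) =
    ⊥-elim (x∉ (∈-marked⁺ isFall (subst (λ p → occurs isFall p ≡ true) (sym x≡0) (cong not first-0))))
  ... | inj₂ (w , w+1≡x , _) with bit w in w-bit
  ...   | false = w , w+1≡x , w-bit
  ...   | true  = ⊥-elim (x∉ (∈-marked⁺ isFall (subst (λ p → occurs isFall p ≡ true) w+1≡x
                    (cong₂ _∧_ w-bit (cong not (trans (cong (bitAt b) w+1≡x) (zero⇒bit x∈)))))))

  module _ {z z′ : V} (z′+1≡z : suc (toℕ z′) ≡ toℕ z) (z-0 : bit z ≡ false) (z′-0 : bit z′ ≡ false) where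

    rises+z : Subset (length b)
    rises+z = rises ∪ ⁅ z ⁆

    ∣rises∣<∣rises+z∣ : ∣ rises ∣ < ∣ rises+z ∣
    ∣rises∣<∣rises+z∣ = p⊂q⇒∣p∣<∣q∣ (p⊆p∪q ⁅ z ⁆ , z , x∈p∪q⁺ (inj₂ (x∈⁅x⁆ z)) , zero∉rises z-0)

    private
      z′<z : toℕ z′ < toℕ z
      z′<z = subst (toℕ z′ <_) z′+1≡z ≤-refl

      zero∉ : ∀ {w} → bit w ≡ false → w ≢ z → w ∉ rises+z
      zero∉ w-0 w≢z w∈ with x∈p∪q⁻ rises ⁅ z ⁆ w∈
      ... | inj₁ w∈rises = zero∉rises w-0 w∈rises
      ... | inj₂ w∈z     = w≢z (x∈⁅y⁆⇒x≡y z w∈z)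

      z′∉ : z′ ∉ rises+z
      z′∉ = zero∉ z′-0 λ z′≡z → <-irrefl (cong toℕ z′≡z) z′<z

      Separator : V → V → Set
      Separator u v = ∃ λ w → w ∉ rises+z × Separates u v w

      z-rise : ∀ {v} → v ∈ rises → toℕ z < toℕ v → Separator z v
      z-rise v∈ z<v = z′ , z′∉ , zero-separates (proj₁ (rise⇒ v∈)) z′-0 (<-trans z′<z z<v) (inj₂ z-0)

      rise-z : ∀ {u} → u ∈ rises → toℕ u < toℕ z → Separator u z
      rise-z {u} u∈ u<z with rise⇒ u∈
      ... | u-1 , w , w+1≡u , w-0 =
        w , zero∉ w-0 (λ { refl → <-asym w<u u<z }) , separates-sym (zero-separates u-1 w-0 w<u (inj₂ z-0))
        where
        w<u : toℕ w < toℕ u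
        w<u = subst (toℕ w <_) w+1≡u ≤-refl

      rise-rise : ∀ {u v} → u ∈ rises → v ∈ rises → toℕ u < toℕ v → Separator u v
      rise-rise {u} {v} u∈ v∈ u<v with rise-separator u∈ v∈ u<v
      ... | w , w+1≡v , w-0 , sep with w Fin.≟ z
      ...   | no w≢z  = w , zero∉ w-0 w≢z , sep
      ...   | yes refl = z′ , z′∉ , zero-separates (proj₁ (rise⇒ v∈)) z′-0 (<-trans z′<z z<v) (inj₁ u<z′)
        where
        u-1 = proj₁ (rise⇒ u∈)
        z<v : toℕ z < toℕ v
        z<v = subst (toℕ z <_) w+1≡v ≤-refl
        u<z : toℕ u < toℕ z
        u<z = one<zero u-1 z-0 (subst (toℕ u <_) (sym w+1≡v) u<v)
        u<z′ : toℕ u < toℕ z′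
        u<z′ = one<zero u-1 z′-0 (subst (toℕ u <_) (sym z′+1≡z) u<z)

      separator : ∀ {u v} → u ∈ rises+z → v ∈ rises+z → toℕ u < toℕ v → Separator u v
      separator u∈ v∈ u<v with x∈p∪q⁻ rises ⁅ z ⁆ u∈ | x∈p∪q⁻ rises ⁅ z ⁆ v∈
      ... | inj₂ u∈z | inj₂ v∈z with refl ← x∈⁅y⁆⇒x≡y z u∈z | refl ← x∈⁅y⁆⇒x≡y z v∈z = ⊥-elim (<-irrefl refl u<v)
      ... | inj₂ u∈z | inj₁ v∈rises with refl ← x∈⁅y⁆⇒x≡y z u∈z = z-rise v∈rises u<v
      ... | inj₁ u∈rises | inj₂ v∈z with refl ← x∈⁅y⁆⇒x≡y z v∈z = rise-z u∈rises u<v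
      ... | inj₁ u∈rises | inj₁ v∈rises = rise-rise u∈rises v∈rises u<v

    ∁rises+z-resolving : Resolving E (∁ rises+z)
    ∁rises+z-resolving = separated⇒∁-resolving rises+z separator

-- Block codes

Positive Long SingleZero : ℕ × ℕ → Set
Positive   = uncurry λ s t → 1 ≤ s × 1 ≤ t
Long       = uncurry λ s t → 1 < s × 1 < t
SingleZero = uncurry λ s t → s ≡ 1

blockCode-∷ : ∀ s t bs → blockCode ((s , t) ∷ bs) ≡ replicate s false ++ (replicate t true ++ blockCode bs)
blockCode-∷ s t bs = ++-assoc (replicate s false) (replicate t true) (blockCode bs)

indicator : Bool → ℕ
indicator true  = 1
indicator false = 0

∣marks-∷∣ : ∀ f pr x b → ∣ marks f pr (x ∷ b) ∣ ≡ indicator (f pr x) + ∣ marks f x b ∣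
∣marks-∷∣ f pr x b with f pr x
... | true  = refl
... | false = refl

∣marks-replicate∣ : ∀ f x k b → ∣ marks f x (replicate k x ++ b) ∣ ≡ k * indicator (f x x) + ∣ marks f x b ∣
∣marks-replicate∣ f x zero    b = refl
∣marks-replicate∣ f x (suc k) b = begin
  ∣ marks f x (x ∷ replicate k x ++ b) ∣                       ≡⟨ ∣marks-∷∣ f x x (replicate k x ++ b) ⟩
  indicator (f x x) + ∣ marks f x (replicate k x ++ b) ∣        ≡⟨ cong (indicator (f x x) +_) (∣marks-replicate∣ f x k b) ⟩
  indicator (f x x) + (k * indicator (f x x) + ∣ marks f x b ∣) ≡⟨ sym (+-assoc (indicator (f x x)) _ _) ⟩
  suc k * indicator (f x x) + ∣ marks f x b ∣                   ∎
  where open ≡-Reasoning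

-- After a 1, the block 0^(s+1) 1^(t+1) shows f the pairs (1,0) once, (0,0) s times, (0,1) once
-- and (1,1) t times.
∣marks-blockCode∣ : ∀ f (g : ℕ → ℕ → ℕ) →
  (∀ s t → (indicator (f true false) + s * indicator (f false false)) + (indicator (f false true) + t * indicator (f true true))
           ≡ g (suc s) (suc t)) →
  ∀ {bs} → All Positive bs → ∣ marks f true (blockCode bs) ∣ ≡ sum (map (uncurry g) bs)
∣marks-blockCode∣ f g per-block {[]} [] = refl
∣marks-blockCode∣ f g per-block {(suc s , suc t) ∷ bs} ((s≤s _ , s≤s _) ∷ pos) = begin
  ∣ marks f true (blockCode ((suc s , suc t) ∷ bs)) ∣
    ≡⟨ cong (λ c → ∣ marks f true c ∣) (blockCode-∷ (suc s) (suc t) bs) ⟩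
  ∣ marks f true (false ∷ replicate s false ++ (true ∷ replicate t true ++ rest)) ∣
    ≡⟨ ∣marks-∷∣ f true false (replicate s false ++ (true ∷ replicate t true ++ rest)) ⟩
  i₁₀ + ∣ marks f false (replicate s false ++ (true ∷ replicate t true ++ rest)) ∣
    ≡⟨ cong (i₁₀ +_) (∣marks-replicate∣ f false s _) ⟩
  i₁₀ + (s * i₀₀ + ∣ marks f false (true ∷ replicate t true ++ rest) ∣)
    ≡⟨ cong (λ c → i₁₀ + (s * i₀₀ + c)) (∣marks-∷∣ f false true (replicate t true ++ rest)) ⟩
  i₁₀ + (s * i₀₀ + (i₀₁ + ∣ marks f true (replicate t true ++ rest) ∣))
    ≡⟨ cong (λ c → i₁₀ + (s * i₀₀ + (i₀₁ + c))) (∣marks-replicate∣ f true t rest) ⟩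
  i₁₀ + (s * i₀₀ + (i₀₁ + (t * i₁₁ + ∣ marks f true rest ∣)))
    ≡⟨ regroup i₁₀ (s * i₀₀) i₀₁ (t * i₁₁) _ ⟩
  ((i₁₀ + s * i₀₀) + (i₀₁ + t * i₁₁)) + ∣ marks f true rest ∣
    ≡⟨ cong₂ _+_ (per-block s t) (∣marks-blockCode∣ f g per-block pos) ⟩
  g (suc s) (suc t) + sum (map (uncurry g) bs) ∎
  where
  open ≡-Reasoning
  rest = blockCode bs
  i₁₀ = indicator (f true false)
  i₀₀ = indicator (f false false)
  i₀₁ = indicator (f false true)
  i₁₁ = indicator (f true true)
  regroup : ∀ a b c d e → a + (b + (c + (d + e))) ≡ ((a + b) + (c + d)) + e
  regroup = solve-∀

∣zeros-blockCode∣ : ∀ {bs} → All Positive bs → ∣ marks isZero true (blockCode bs) ∣ ≡ sum (map proj₁ bs)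
∣zeros-blockCode∣ = ∣marks-blockCode∣ isZero (λ s _ → s) λ s t → per-block s t
  where
  per-block : ∀ s t → (1 + s * 1) + (0 + t * 0) ≡ suc s
  per-block = solve-∀

sum-map-const : ∀ c (bs : List (ℕ × ℕ)) → sum (map (λ _ → c) bs) ≡ c * length bs
sum-map-const c []       = sym (*-zeroʳ c)
sum-map-const c (_ ∷ bs) = trans (cong (c +_) (sum-map-const c bs)) (sym (*-suc c (length bs)))

∣marks-blockCode∣-const : ∀ f c → (∀ s t → (indicator (f true false) + s * indicator (f false false))
                                            + (indicator (f false true) + t * indicator (f true true)) ≡ c) →
                          ∀ {bs} → All Positive bs → ∣ marks f true (blockCode bs) ∣ ≡ c * length bs
∣marks-blockCode∣-const f c per-block {bs} pos = trans (∣marks-blockCode∣ f (λ _ _ → c) per-block pos) (sum-map-const c bs)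

∣runStarts-blockCode∣ : ∀ {bs} → All Positive bs → ∣ marks isRunStart true (blockCode bs) ∣ ≡ 2 * length bs
∣runStarts-blockCode∣ = ∣marks-blockCode∣-const isRunStart 2 λ s t → per-block s t
  where
  per-block : ∀ s t → (1 + s * 0) + (1 + t * 0) ≡ 2
  per-block = solve-∀

∣rises-blockCode∣ : ∀ {bs} → All Positive bs → ∣ marks isRise true (blockCode bs) ∣ ≡ 1 * length bs
∣rises-blockCode∣ = ∣marks-blockCode∣-const isRise 1 λ s t → per-block s t
  where
  per-block : ∀ s t → (0 + s * 0) + (1 + t * 0) ≡ 1
  per-block = solve-∀

∣falls-blockCode∣ : ∀ {bs} → All Positive bs → ∣ marks isFall true (blockCode bs) ∣ ≡ 1 * length bs
∣falls-blockCode∣ = ∣marks-blockCode∣-const isFall 1 λ s t → per-block s t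
  where
  per-block : ∀ s t → (1 + s * 0) + (0 + t * 0) ≡ 1
  per-block = solve-∀

length-blockCode : ∀ bs → length (blockCode bs) ≡ sum (map (uncurry _+_) bs)
length-blockCode []             = refl
length-blockCode ((s , t) ∷ bs) = begin
  length (blockCode ((s , t) ∷ bs))
    ≡⟨ cong length (blockCode-∷ s t bs) ⟩
  length (replicate s false ++ (replicate t true ++ blockCode bs))
    ≡⟨ length-++ (replicate s false) ⟩
  length (replicate s false) + length (replicate t true ++ blockCode bs)
    ≡⟨ cong₂ _+_ (length-replicate s) (length-++ (replicate t true)) ⟩
  s + (length (replicate t true) + length (blockCode bs))
    ≡⟨ cong₂ (λ x y → s + (x + y)) (length-replicate t) (length-blockCode bs) ⟩
  s + (t + sum (map (uncurry _+_) bs))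
    ≡⟨ sym (+-assoc s t _) ⟩
  s + t + sum (map (uncurry _+_) bs) ∎
  where open ≡-Reasoning

sum-∸+ : ∀ c {bs} → All (uncurry λ s t → c ≤ s + t) bs →
         sum (map (uncurry λ s t → s + t ∸ c) bs) + c * length bs ≡ sum (map (uncurry _+_) bs)
sum-∸+ c {[]}             []           = *-zeroʳ c
sum-∸+ c {(s , t) ∷ bs} (c≤s+t ∷ cs) = begin
  (s + t ∸ c + S) + c * suc (length bs)  ≡⟨ cong (s + t ∸ c + S +_) (*-suc c (length bs)) ⟩
  (s + t ∸ c + S) + (c + c * length bs)  ≡⟨ regroup (s + t ∸ c) S c (c * length bs) ⟩
  (s + t ∸ c + c) + (S + c * length bs)  ≡⟨ cong₂ _+_ (m∸n+n≡m c≤s+t) (sum-∸+ c cs) ⟩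
  s + t + sum (map (uncurry _+_) bs)     ∎
  where
  open ≡-Reasoning
  S = sum (map (uncurry λ s t → s + t ∸ c) bs)
  regroup : ∀ a b c d → (a + b) + (c + d) ≡ (a + c) + (b + d)
  regroup = solve-∀

lowerSum+2k≡n : ∀ {bs} → All Positive bs → lowerSum bs + 2 * length bs ≡ length (blockCode bs)
lowerSum+2k≡n {bs} pos = trans (sum-∸+ 2 (All.map (λ (1≤s , 1≤t) → +-mono-≤ 1≤s 1≤t) pos)) (sym (length-blockCode bs))

upperSum+k≡n : ∀ {bs} → All Positive bs → upperSum bs + 1 * length bs ≡ length (blockCode bs)
upperSum+k≡n {bs} pos = trans (sum-∸+ 1 (All.map (λ (1≤s , _) → ≤-trans 1≤s (m≤m+n _ _)) pos)) (sym (length-blockCode bs))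

x∷replicate≡replicate∷ʳx : ∀ k (x : Bool) → x ∷ replicate k x ≡ replicate k x ++ x ∷ []
x∷replicate≡replicate∷ʳx zero    x = refl
x∷replicate≡replicate∷ʳx (suc k) x = cong (x ∷_) (x∷replicate≡replicate∷ʳx k x)

blockCode-ends-with-1 : ∀ {bs} → 1 ≤ length bs → All Positive bs → ∃ λ L → blockCode bs ≡ L ++ true ∷ []
blockCode-ends-with-1 {(s , suc t) ∷ []} _ ((_ , s≤s _) ∷ []) = replicate s false ++ replicate t true , (begin
  blockCode ((s , suc t) ∷ [])                      ≡⟨ blockCode-∷ s (suc t) [] ⟩
  replicate s false ++ (true ∷ replicate t true ++ []) ≡⟨ cong (replicate s false ++_) (++-identityʳ _) ⟩
  replicate s false ++ (true ∷ replicate t true)       ≡⟨ cong (replicate s false ++_) (x∷replicate≡replicate∷ʳx t true) ⟩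
  replicate s false ++ (replicate t true ++ true ∷ []) ≡⟨ sym (++-assoc (replicate s false) _ _) ⟩
  (replicate s false ++ replicate t true) ++ true ∷ [] ∎)
  where open ≡-Reasoning
blockCode-ends-with-1 {(s , t) ∷ bs@(_ ∷ _)} _ (_ ∷ pos) with blockCode-ends-with-1 (s≤s z≤n) pos
... | L , ends = block ++ L , trans (cong (block ++_) ends) (sym (++-assoc block L (true ∷ [])))
  where block = replicate s false ++ replicate t true

bitAt-∷ʳ : ∀ L (x : Bool) → bitAt (L ++ x ∷ []) (length L) ≡ x
bitAt-∷ʳ []      x = refl
bitAt-∷ʳ (_ ∷ L) x = bitAt-∷ʳ L x

length-∷ʳ : ∀ L (x : Bool) → length (L ++ x ∷ []) ≡ suc (length L)
length-∷ʳ L x = trans (length-++ L) (+-comm (length L) 1)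

isolated-∷ : ∀ {pr x L} → (occursIn isRunStart pr (x ∷ L) 1 ≡ true → pr xor x ≡ false) →
             RunStartsIsolated x L → RunStartsIsolated pr (x ∷ L)
isolated-∷ first isolated zero    = first
isolated-∷ first isolated (suc q) = isolated q

isolated-replicate : ∀ {x L} k → RunStartsIsolated x L → RunStartsIsolated x (replicate k x ++ L)
isolated-replicate         zero    isolated = isolated
isolated-replicate {x} {L} (suc k) isolated = isolated-∷ (λ _ → xor-same x) (isolated-replicate k isolated)

isolated-blockCode : ∀ {bs} → All Long bs → RunStartsIsolated true (blockCode bs)
isolated-blockCode {[]} [] = λ _ ()
isolated-blockCode {(suc (suc s) , suc (suc t)) ∷ bs} ((s≤s (s≤s _) , s≤s (s≤s _)) ∷ long) =
  subst (RunStartsIsolated true) (sym (blockCode-∷ (2 + s) (2 + t) bs))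
    (isolated-∷ (λ ()) (isolated-replicate (suc s)
      (isolated-∷ (λ ()) (isolated-replicate (suc t) (isolated-blockCode long)))))

length≤∑s : ∀ {bs} → All Positive bs → length bs ≤ sum (map proj₁ bs)
length≤∑s []               = z≤n
length≤∑s ((1≤s , _) ∷ pos) = +-mono-≤ 1≤s (length≤∑s pos)

∑s≡length : ∀ {bs} → All SingleZero bs → sum (map proj₁ bs) ≡ length bs
∑s≡length []            = refl
∑s≡length (refl ∷ ones) = cong suc (∑s≡length ones)

length<∑s : ∀ {bs} → All Positive bs → ¬ All SingleZero bs → length bs < sum (map proj₁ bs)
length<∑s {[]}           []              not-ones = ⊥-elim (not-ones [])
length<∑s {(s , t) ∷ bs} ((1≤s , _) ∷ pos) not-ones with s ≟ 1
... | yes refl = s≤s (length<∑s pos (not-ones ∘ (refl ∷_)))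
... | no  s≢1  = +-mono-≤ (≤∧≢⇒< 1≤s (s≢1 ∘ sym)) (length≤∑s pos)

blockCode-starts-with-0 : ∀ {bs} → 1 ≤ length bs → All Positive bs → bitAt (blockCode bs) 0 ≡ false
blockCode-starts-with-0 {(suc s , t) ∷ bs} _ ((s≤s _ , _) ∷ _) = refl

module BlockCodeGraph {bs : List (ℕ × ℕ)} (nonempty : 1 ≤ length bs) (pos : All Positive bs) where

  private
    ends = blockCode-ends-with-1 nonempty pos
    init = proj₁ ends

  open Threshold (blockCode bs) (length init) (trans (cong length (proj₂ ends)) (length-∷ʳ init true))
    (blockCode-starts-with-0 nonempty pos) (trans (cong (λ c → bitAt c (length init)) (proj₂ ends)) (bitAt-∷ʳ init true)) public

  lowerSum≤∣W∣ : ∀ {W} → Resolving E W → lowerSum bs ≤ ∣ W ∣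
  lowerSum≤∣W∣ {W} res = +≡+⇒≤ (trans (lowerSum+2k≡n pos) (sym (∣p∣+∣∁p∣≡n W)))
    (subst (∣ ∁ W ∣ ≤_) (∣runStarts-blockCode∣ pos) (∣∁W∣≤∣runStarts∣ res))

  upperSum≤∣W∣ : ∀ {W} → All SingleZero bs → Resolving E W → upperSum bs ≤ ∣ W ∣
  upperSum≤∣W∣ {W} ones res = +≡+⇒≤ (trans (upperSum+k≡n pos) (sym (∣p∣+∣∁p∣≡n W)))
    (subst (∣ ∁ W ∣ ≤_) ∣zeros∣≡k (∣∁W∣≤∣zeros∣ res))
    where
    ∣zeros∣≡k : ∣ zeros ∣ ≡ 1 * length bs
    ∣zeros∣≡k = trans (∣zeros-blockCode∣ pos) (trans (∑s≡length ones) (sym (*-identityˡ _)))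

  ∣∁rises∣≤upperSum : ∣ ∁ rises ∣ ≤ upperSum bs
  ∣∁rises∣≤upperSum =
    +≡+⇒≤ (trans (∣∁p∣+∣p∣≡n rises) (sym (upperSum+k≡n pos))) (≤-reflexive (sym (∣rises-blockCode∣ pos)))

  ∣∁runStarts∣≤lowerSum : ∣ ∁ runStarts ∣ ≤ lowerSum bs
  ∣∁runStarts∣≤lowerSum =
    +≡+⇒≤ (trans (∣∁p∣+∣p∣≡n runStarts) (sym (lowerSum+2k≡n pos))) (≤-reflexive (sym (∣runStarts-blockCode∣ pos)))

  resolving-below-upperSum : ¬ All SingleZero bs → ∃ λ W → Resolving E W × ∣ W ∣ < upperSum bs
  resolving-below-upperSum not-ones = from-doubled-zero (∣q∣<∣p∣⇒∃∈p∉q ∣falls∣<∣zeros∣)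
    where
    ∣falls∣<∣zeros∣ : ∣ falls ∣ < ∣ zeros ∣
    ∣falls∣<∣zeros∣ = subst₂ _<_ (trans (sym (*-identityˡ _)) (sym (∣falls-blockCode∣ pos))) (sym (∣zeros-blockCode∣ pos))
                                 (length<∑s pos not-ones)
    from-doubled-zero : (∃ λ z → z ∈ zeros × z ∉ falls) → ∃ λ W → Resolving E W × ∣ W ∣ < upperSum bs
    from-doubled-zero (z , z∈ , z∉) =
      let (z′ , z′+1≡z , z′-0) = zero-after-zero z∈ z∉
          z-0 = zero⇒bit z∈
          U = rises+z z′+1≡z z-0 z′-0
      in ∁ U , ∁rises+z-resolving z′+1≡z z-0 z′-0 ,
         +≡+⇒< (trans (∣∁p∣+∣p∣≡n U) (sym (upperSum+k≡n pos)))
               (subst (_< ∣ U ∣) (∣rises-blockCode∣ pos) (∣rises∣<∣rises+z∣ z′+1≡z z-0 z′-0))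

  metricDimension-bounds : ∀ {β} → IsMetricDim E β →
    (lowerSum bs ≤ β × β ≤ upperSum bs) × (All Long bs → β ≡ lowerSum bs) × (β ≡ upperSum bs ⇔ All SingleZero bs)
  metricDimension-bounds {β} ((W₀ , W₀-resolving , refl) , least) =
    (lower , upper) , long⇒lower , mk⇔ upper⇒singleZero singleZero⇒upper
    where
    lower : lowerSum bs ≤ β
    lower = lowerSum≤∣W∣ W₀-resolving
    upper : β ≤ upperSum bs
    upper = ≤-trans (least _ ∁rises-resolving) ∣∁rises∣≤upperSum
    long⇒lower : All Long bs → β ≡ lowerSum bs
    long⇒lower long =
      ≤-antisym (≤-trans (least _ (∁runStarts-resolving (isolated-blockCode long))) ∣∁runStarts∣≤lowerSum) lower
    singleZero⇒upper : All SingleZero bs → β ≡ upperSum bs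
    singleZero⇒upper ones = ≤-antisym upper (upperSum≤∣W∣ ones W₀-resolving)
    upper⇒singleZero : β ≡ upperSum bs → All SingleZero bs
    upper⇒singleZero β≡upper with All.all? (λ (s , _) → s ≟ 1) bs
    ... | yes ones    = ones
    ... | no not-ones =
      let (W , W-resolving , ∣W∣<upper) = resolving-below-upperSum not-ones
      in ⊥-elim (<-irrefl β≡upper (≤-<-trans (least W W-resolving) ∣W∣<upper))

theorem2p6 : (bs : List (ℕ × ℕ)) → 1 ≤ length bs →
    All (uncurry λ s t → 1 ≤ s × 1 ≤ t) bs →
    ∃ λ β → IsMetricDim (ThresholdAdj (blockCode bs)) β
    × (lowerSum bs ≤ β × β ≤ upperSum bs)
    × (All (uncurry λ s t → 1 < s × 1 < t) bs → β ≡ lowerSum bs)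
    × (β ≡ upperSum bs ⇔ All (uncurry λ s t → s ≡ 1) bs)
theorem2p6 bs nonempty pos =
  let (β , isDim) = metricDimension resolving? in β , isDim , metricDimension-bounds isDim
  where open BlockCodeGraph nonempty pos
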